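{- In the discrete data-center optimization problem, for every $\tau\in\{1,\dots,T\}$ and every integer $x$ with $1\le x\le x^U_\tau$, we have $\hat C^L_\tau(x)-\hat C^L_\tau(x-1)\le\beta$.
   Context: Discrete data-center optimization problem: given $T,m\in\mathbb{N}$, $\beta>0$ and convex functions $f_1,\dots,f_T:\{0,\dots,m\}\to\mathbb{R}_{\ge0}$ (convex meaning $f_t(x+1)-f_t(x)$ nondecreasing). For $\tau\in\{1,\dots,T\}$ and $X=(x_1,\dots,x_\tau)\in\{0,\dots,m\}^\tau$ (with $x_0=0$) define $C^L_\tau(X)=\sum_{t=1}^\tau f_t(x_t)+\beta\sum_{t=1}^\tau(x_t-x_{t-1})^+$ and $C^U_\tau(X)=\sum_{t=1}^\tau f_t(x_t)+\beta\sum_{t=1}^\tau(x_{t-1}-x_t)^+$, where $(y)^+=\max(0,y)$. Define $\hat C^L_\tau(x)=\min_{x_1,\dots,x_{\tau-1}}C^L_\tau((x_1,\dots,x_{\tau-1},x))$. Let $x^U_\tau$ be the largest value of the last component $x_\tau$ among all minimizers of $C^U_\tau$ over $\{0,\dots,m\}^\tau$.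
   Formalization: The parameter β and the values of the cost functions $f_1,\dots,f_T$ are rational rather than real. -}

module Defs where

open import Data.Nat using (ℕ; zero; suc; _∸_; pred) renaming (_≤_ to _≤ℕ_; _+_ to _+ℕ_)
open import Data.Integer using (+_)
open import Data.Rational using (ℚ; 0ℚ; _/_; _+_; _*_; _-_; _≤_; _⊓_)
open import Data.List using (List; []; _∷_; [_]; map; concatMap; foldr; upTo)
open import Data.Vec using (Vec; []; _∷_; _∷ʳ_)
open import Data.Vec.Relation.Unary.All using (All)
open import Data.Product using (Σ; _×_)
open import Relation.Binary.PropositionalEquality using (_≡_)

toℚ : ℕ → ℚ
toℚ n = + n / 1

-- A problem instance: cost functions are indexed by time t (1-based) and
-- state x ∈ {0,…,m}; values outside these ranges are irrelevant.
CostFns : Set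
CostFns = ℕ → ℕ → ℚ

Admissible : (T m : ℕ) → CostFns → Set
Admissible T m f =
  (∀ t x → 1 ≤ℕ t → t ≤ℕ T → x ≤ℕ m → 0ℚ ≤ f t x) ×
  (∀ t x → 1 ≤ℕ t → t ≤ℕ T → suc (suc x) ≤ℕ m →
     f t (suc x) - f t x ≤ f t (suc (suc x)) - f t (suc x))

-- Cost of a schedule starting at time t from previous state prev.
-- (a ∸ b) in ℕ is exactly (a - b)⁺.
costL : CostFns → ℚ → (t prev : ℕ) → ∀ {n} → Vec ℕ n → ℚ
costL f β t prev []       = 0ℚ
costL f β t prev (x ∷ xs) = f t x + β * toℚ (x ∸ prev) + costL f β (suc t) x xs

costU : CostFns → ℚ → (t prev : ℕ) → ∀ {n} → Vec ℕ n → ℚ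
costU f β t prev []       = 0ℚ
costU f β t prev (x ∷ xs) = f t x + β * toℚ (prev ∸ x) + costU f β (suc t) x xs

CL : CostFns → ℚ → ∀ {τ} → Vec ℕ τ → ℚ
CL f β X = costL f β 1 0 X

CU : CostFns → ℚ → ∀ {τ} → Vec ℕ τ → ℚ
CU f β X = costU f β 1 0 X

allVecs : (m n : ℕ) → List (Vec ℕ n)
allVecs m zero    = [ [] ]
allVecs m (suc n) = concatMap (λ x → map (x ∷_) (allVecs m n)) (upTo (suc m))

minList : List ℚ → ℚ
minList []       = 0ℚ
minList (q ∷ qs) = foldr _⊓_ q qs

hatCL : (m : ℕ) → CostFns → ℚ → (τ x : ℕ) → ℚ
hatCL m f β τ x = minList (map (λ P → CL f β (P ∷ʳ x)) (allVecs m (pred τ)))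

-- last component (τ ≥ 1 in all uses; 0 for the empty vector)
lastOr0 : ∀ {n} → Vec ℕ n → ℕ
lastOr0 []           = 0
lastOr0 (x ∷ [])     = x
lastOr0 (x ∷ y ∷ xs) = lastOr0 (y ∷ xs)

IsMinimizerU : (m : ℕ) → CostFns → ℚ → (τ : ℕ) → Vec ℕ τ → Set
IsMinimizerU m f β τ X =
  All (_≤ℕ m) X × (∀ (Y : Vec ℕ τ) → All (_≤ℕ m) Y → CU f β X ≤ CU f β Y)

IsXU : (m : ℕ) → CostFns → ℚ → (τ y : ℕ) → Set
IsXU m f β τ y =
  Σ (Vec ℕ τ) (λ X → IsMinimizerU m f β τ X × lastOr0 X ≡ y) ×
  (∀ (X : Vec ℕ τ) → IsMinimizerU m f β τ X → lastOr0 X ≤ℕ y)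

{-# OPTIONS --safe #-}
-- Let X be a minimiser of C^U ending in x^U and let Y be a schedule ending in
-- x − 1 that realises Ĉ^L(x − 1).  Replace the pair (X, Y) componentwise by
-- (X ⊔⁻ Y, X ⊓⁺ Y), where p ⊔⁻ q = max(p, q + 1) − 1 and p ⊓⁺ q = min(p, q + 1):
-- convexity of each f_t and submodularity of truncated subtraction show that
-- C^U(X ⊔⁻ Y) + C^U(X ⊓⁺ Y) ≤ C^U(X) + C^U(Y), so optimality of X gives
-- C^U(X ⊓⁺ Y) ≤ C^U(Y).  The schedule X ⊓⁺ Y ends in min(x^U, x) = x, and
-- C^L = C^U + β·(final state) for every schedule, since the upward moves minus
-- the downward moves telescope.  Hence
--   Ĉ^L(x) ≤ C^U(X ⊓⁺ Y) + βx ≤ C^U(Y) + β(x − 1) + β = Ĉ^L(x − 1) + β.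
module Submission where

open import Defs
open import Data.Nat using (ℕ; _≤_; _∸_)
open import Data.Rational using (ℚ; 0ℚ; _<_; _-_) renaming (_≤_ to _≤ℚ_)

open import Algebra.Bundles using (CommutativeMonoid)
open import Data.Integer using (+_; +≤+)
import Data.Integer as ℤ
import Data.Integer.Properties as ℤ
open import Data.List using ([]; _∷_; map; upTo)
open import Data.List.Membership.Propositional using (_∈_)
open import Data.List.Membership.Propositional.Properties
  using (∈-map⁺; ∈-map⁻; ∈-concat⁺′; ∈-concat⁻′; ∈-upTo⁺; ∈-upTo⁻)
open import Data.List.Relation.Unary.Any using (here; there)
open import Data.Nat using (suc; zero; z≤n; s≤s; _⊔_; _⊓_; _≤′_; ≤′-reflexive; ≤′-step)
  renaming (_+_ to _+ℕ_)
import Data.Nat.Properties as ℕ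
open import Data.Nat.Coprimality using (1-coprimeTo) renaming (sym to coprime-sym)
open import Data.Product using (Σ-syntax; _×_; _,_)
open import Data.Rational using (mkℚ; _/_; _+_; _*_; -_; NonNegative; positive; *≤*)
import Data.Rational.Properties as ℚ
open import Data.Rational.Solver using (module +-*-Solver)
open import Data.Sum using (inj₁; inj₂)
open import Data.Vec using (Vec; []; _∷_; _∷ʳ_; last; initLast; zipWith; replicate)
open import Data.Vec.Properties using (last-∷ʳ)
open import Data.Vec.Relation.Unary.All using (All; []; _∷_)
open import Relation.Binary.PropositionalEquality
  using (_≡_; refl; sym; trans; cong; cong₂; subst; subst₂)

open import Algebra.Properties.CommutativeSemigroup
  (CommutativeMonoid.commutativeSemigroup ℚ.+-0-commutativeMonoid) using (interchange)
open +-*-Solver using (solve; _:+_; :-_; _:-_; _:=_)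
open ℚ.≤-Reasoning

∸-submodular : ∀ a b c d → (a ⊔ b ∸ (c ⊔ d)) +ℕ (a ⊓ b ∸ c ⊓ d) ≤ (a ∸ c) +ℕ (b ∸ d)
∸-submodular zero b c d
  rewrite ℕ.0∸n≡0 (c ⊓ d) | ℕ.0∸n≡0 c | ℕ.+-identityʳ (b ∸ (c ⊔ d)) =
  ℕ.∸-monoʳ-≤ b (ℕ.m≤n⊔m c d)
∸-submodular (suc a) zero c d
  rewrite ℕ.0∸n≡0 (c ⊓ d) | ℕ.0∸n≡0 d | ℕ.+-identityʳ (suc a ∸ (c ⊔ d)) | ℕ.+-identityʳ (suc a ∸ c) =
  ℕ.∸-monoʳ-≤ (suc a) (ℕ.m≤m⊔n c d)
∸-submodular (suc a) (suc b) zero d = case-c≡0 (suc a) (suc b) d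
  where
  case-c≡0 : ∀ a b d → (a ⊔ b ∸ d) +ℕ a ⊓ b ≤ a +ℕ (b ∸ d)
  case-c≡0 zero b d = ℕ.≤-reflexive (ℕ.+-identityʳ (b ∸ d))
  case-c≡0 (suc a) zero d
    rewrite ℕ.0∸n≡0 d | ℕ.+-identityʳ (suc a ∸ d) | ℕ.+-identityʳ a = ℕ.m∸n≤m (suc a) d
  case-c≡0 (suc a) (suc b) zero
    rewrite ℕ.+-suc (a ⊔ b) (a ⊓ b) | ℕ.+-suc a b = s≤s (s≤s (case-c≡0 a b zero))
  case-c≡0 (suc a) (suc b) (suc d)
    rewrite ℕ.+-suc (a ⊔ b ∸ d) (a ⊓ b) = s≤s (case-c≡0 a b d)
∸-submodular (suc a) (suc b) (suc c) zero
  rewrite ℕ.⊔-comm a b | ℕ.⊓-comm a b | ℕ.+-comm (a ∸ c) (suc b) =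
  ∸-submodular (suc b) (suc a) zero (suc c)
∸-submodular (suc a) (suc b) (suc c) (suc d) = ∸-submodular a b c d

∸-+-swap : ∀ m n → (m ∸ n) +ℕ n ≡ (n ∸ m) +ℕ m
∸-+-swap zero    zero    = refl
∸-+-swap zero    (suc n) = sym (ℕ.+-identityʳ (suc n))
∸-+-swap (suc m) zero    = ℕ.+-identityʳ (suc m)
∸-+-swap (suc m) (suc n) =
  trans (ℕ.+-suc (m ∸ n) n) (trans (cong suc (∸-+-swap m n)) (sym (ℕ.+-suc (n ∸ m) m)))

infixl 6 _⊔⁻_
infixl 7 _⊓⁺_

_⊔⁻_ : ℕ → ℕ → ℕ
p ⊔⁻ q = p ⊔ suc q ∸ 1

_⊓⁺_ : ℕ → ℕ → ℕ
p ⊓⁺ q = p ⊓ suc q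

⊔⁻-≤ : ∀ {m p q} → p ≤ m → q ≤ m → p ⊔⁻ q ≤ m
⊔⁻-≤ {m} p≤m q≤m = ℕ.∸-monoˡ-≤ 1 (ℕ.⊔-lub (ℕ.m≤n⇒m≤1+n p≤m) (s≤s q≤m))

⊓⁺-≤ : ∀ {m p q} → p ≤ m → p ⊓⁺ q ≤ m
⊓⁺-≤ {p = p} {q} p≤m = ℕ.≤-trans (ℕ.m⊓n≤m p (suc q)) p≤m

x∸1∸[p⊔⁻q]≡x∸[p⊔1+q] : ∀ x p q → x ∸ 1 ∸ (p ⊔⁻ q) ≡ x ∸ (p ⊔ suc q)
x∸1∸[p⊔⁻q]≡x∸[p⊔1+q] x zero    q = ℕ.∸-+-assoc x 1 q
x∸1∸[p⊔⁻q]≡x∸[p⊔1+q] x (suc p) q = ℕ.∸-+-assoc x 1 (p ⊔ q)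

⊔⁻-⊓⁺-∸-submodular : ∀ p′ q′ p q →
  (p′ ⊔⁻ q′ ∸ (p ⊔⁻ q)) +ℕ (p′ ⊓⁺ q′ ∸ p ⊓⁺ q) ≤ (p′ ∸ p) +ℕ (q′ ∸ q)
⊔⁻-⊓⁺-∸-submodular p′ q′ p q
  rewrite x∸1∸[p⊔⁻q]≡x∸[p⊔1+q] (p′ ⊔ suc q′) p q = ∸-submodular p′ (suc q′) p (suc q)

[p+q]-p≡q : ∀ p q → (p + q) - p ≡ q
[p+q]-p≡q = solve 2 (λ p q → (p :+ q) :- p := q) refl

+-cancelˡ-≤ : ∀ r {p q} → r + p ≤ℚ r + q → p ≤ℚ q
+-cancelˡ-≤ r {p} {q} h = subst₂ _≤ℚ_ ([p+q]-p≡q r p) ([p+q]-p≡q r q) (ℚ.+-monoˡ-≤ (- r) h)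

p≤q+r⇒p-q≤r : ∀ {p q r} → p ≤ℚ q + r → p - q ≤ℚ r
p≤q+r⇒p-q≤r {p} {q} {r} h = subst (p - q ≤ℚ_) ([p+q]-p≡q q r) (ℚ.+-monoˡ-≤ (- q) h)

p-q≤r-s⇒s+p≤r+q : ∀ {p q r s} → p - q ≤ℚ r - s → s + p ≤ℚ r + q
p-q≤r-s⇒s+p≤r+q {p} {q} {r} {s} h = subst₂ _≤ℚ_ (lhs p q s) (rhs r s q) (ℚ.+-monoˡ-≤ (s + q) h)
  where
  lhs : ∀ x y z → (x - y) + (z + y) ≡ z + x
  lhs = solve 3 (λ x y z → (x :- y) :+ (z :+ y) := z :+ x) refl
  rhs : ∀ x y z → (x - y) + (y + z) ≡ x + z
  rhs = solve 3 (λ x y z → (x :- y) :+ (y :+ z) := x :+ z) refl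

minList-≤ : ∀ {q qs} → q ∈ qs → minList qs ≤ℚ q
minList-≤ {qs = _ ∷ []}      (here refl)          = ℚ.≤-refl
minList-≤ {qs = q₀ ∷ a ∷ as} (here refl)          = ℚ.p≤q⇒r⊓p≤q a (minList-≤ {qs = q₀ ∷ as} (here refl))
minList-≤ {qs = _ ∷ a ∷ _}   (there (here refl))  = ℚ.p⊓q≤p a _
minList-≤ {qs = q₀ ∷ a ∷ as} (there (there q∈as)) = ℚ.p≤q⇒r⊓p≤q a (minList-≤ {qs = q₀ ∷ as} (there q∈as))

minList-∈ : ∀ {q qs} → q ∈ qs → minList qs ∈ qs
minList-∈ {qs = q₀ ∷ qs} _ = minList-∈-∷ q₀ qs
  where
  minList-∈-∷ : ∀ q₀ qs → minList (q₀ ∷ qs) ∈ q₀ ∷ qs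
  minList-∈-∷ q₀ []       = here refl
  minList-∈-∷ q₀ (a ∷ as) with ℚ.⊓-sel a (minList (q₀ ∷ as)) | minList-∈-∷ q₀ as
  ... | inj₁ a⊓r≡a | _           = there (here a⊓r≡a)
  ... | inj₂ a⊓r≡r | here r≡q₀   = here (trans a⊓r≡r r≡q₀)
  ... | inj₂ a⊓r≡r | there r∈as  = there (there (subst (_∈ as) (sym a⊓r≡r) r∈as))

toℚ≡mkℚ : ∀ n → toℚ n ≡ mkℚ (+ n) 0 (coprime-sym (1-coprimeTo n))
toℚ≡mkℚ n = ℚ.normalize-coprime (coprime-sym (1-coprimeTo n))

toℚ-+ : ∀ a b → toℚ (a +ℕ b) ≡ toℚ a + toℚ b
toℚ-+ a b = begin-equality
  toℚ (a +ℕ b)                                ≡⟨ cong₂ (λ i j → (i ℤ.+ j) / 1)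
                                                         (ℤ.*-identityʳ (+ a)) (ℤ.*-identityʳ (+ b)) ⟨
  (+ a ℤ.* + 1 ℤ.+ + b ℤ.* + 1) / 1           ≡⟨ cong₂ _+_ (toℚ≡mkℚ a) (toℚ≡mkℚ b) ⟨
  toℚ a + toℚ b                               ∎

toℚ-mono-≤ : ∀ {a b} → a ≤ b → toℚ a ≤ℚ toℚ b
toℚ-mono-≤ {a} {b} a≤b = subst₂ _≤ℚ_ (sym (toℚ≡mkℚ a)) (sym (toℚ≡mkℚ b))
  (*≤* (ℤ.*-monoʳ-≤-nonNeg (+ 1) (+≤+ a≤b)))

*-toℚ-+ : ∀ r a b → r * toℚ (a +ℕ b) ≡ r * toℚ a + r * toℚ b
*-toℚ-+ r a b = trans (cong (r *_) (toℚ-+ a b)) (ℚ.*-distribˡ-+ r (toℚ a) (toℚ b))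

*-toℚ-suc : ∀ r n → r * toℚ (suc n) ≡ r * toℚ n + r
*-toℚ-suc r n = trans (*-toℚ-+ r 1 n) (trans (cong (_+ r * toℚ n) (ℚ.*-identityʳ r)) (ℚ.+-comm r (r * toℚ n)))

*-toℚ-∸-swap : ∀ r m n → r * toℚ (m ∸ n) + r * toℚ n ≡ r * toℚ (n ∸ m) + r * toℚ m
*-toℚ-∸-swap r m n =
  trans (sym (*-toℚ-+ r (m ∸ n) n)) (trans (cong (λ k → r * toℚ k) (∸-+-swap m n)) (*-toℚ-+ r (n ∸ m) m))

*-toℚ-+-mono-≤ : ∀ r .{{_ : NonNegative r}} {a b c d} → a +ℕ b ≤ c +ℕ d →
                 r * toℚ a + r * toℚ b ≤ℚ r * toℚ c + r * toℚ d
*-toℚ-+-mono-≤ r {a} {b} {c} {d} h =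
  subst₂ _≤ℚ_ (*-toℚ-+ r a b) (*-toℚ-+ r c d) (ℚ.*-monoˡ-≤-nonNeg r (toℚ-mono-≤ h))

Convex : ℕ → (ℕ → ℚ) → Set
Convex m g = ∀ x → suc (suc x) ≤ m → g (suc x) - g x ≤ℚ g (suc (suc x)) - g (suc x)

slope-mono : ∀ {m g} → Convex m g → ∀ {i j} → i ≤′ j → suc j ≤ m → g (suc i) - g i ≤ℚ g (suc j) - g j
slope-mono         convex (≤′-reflexive refl) _     = ℚ.≤-refl
slope-mono {g = g} convex (≤′-step {j} i≤′j)  2+j≤m =
  ℚ.≤-trans (slope-mono {g = g} convex i≤′j (ℕ.<⇒≤ 2+j≤m)) (convex j 2+j≤m)

convex-exchange : ∀ {m g} → Convex m g → ∀ {p q} → p ≤ m → q ≤ m →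
                  g (p ⊔⁻ q) + g (p ⊓⁺ q) ≤ℚ g p + g q
convex-exchange {g = g} convex {p} {q} p≤m q≤m with ℕ.≤-<-connex p (suc q)
... | inj₁ p≤1+q rewrite ℕ.m≤n⇒m⊔n≡n p≤1+q | ℕ.m≤n⇒m⊓n≡m p≤1+q =
  ℚ.≤-reflexive (ℚ.+-comm (g q) (g p))
convex-exchange {g = g} convex {suc p} {q} p≤m q≤m | inj₂ (s≤s q<p)
  rewrite ℕ.m≥n⇒m⊔n≡m (ℕ.<⇒≤ q<p) | ℕ.m≥n⇒m⊓n≡n (ℕ.<⇒≤ q<p) =
  p-q≤r-s⇒s+p≤r+q {g (suc q)} {g q} {g (suc p)} {g p}
    (slope-mono {g = g} convex (ℕ.≤⇒≤′ (ℕ.<⇒≤ q<p)) p≤m)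

lastOr0≡last : ∀ {n} (X : Vec ℕ (suc n)) → lastOr0 X ≡ last X
lastOr0≡last (_ ∷ [])     = refl
lastOr0≡last (_ ∷ y ∷ ys) = lastOr0≡last (y ∷ ys)

last-zipWith : ∀ {A B C : Set} {n} (g : A → B → C) (X : Vec A (suc n)) (Y : Vec B (suc n)) →
               last (zipWith g X Y) ≡ g (last X) (last Y)
last-zipWith g (_ ∷ [])     (_ ∷ [])     = refl
last-zipWith g (_ ∷ x ∷ xs) (_ ∷ y ∷ ys) = last-zipWith g (x ∷ xs) (y ∷ ys)

module _ {A : Set} {P : A → Set} where

  All-last⁺ : ∀ {n} {xs : Vec A (suc n)} → All P xs → P (last xs)
  All-last⁺ {xs = _ ∷ []}    (px ∷ [])  = px
  All-last⁺ {xs = _ ∷ _ ∷ _} (_ ∷ pxs) = All-last⁺ pxs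

  All-∷ʳ⁺ : ∀ {n x} {xs : Vec A n} → All P xs → P x → All P (xs ∷ʳ x)
  All-∷ʳ⁺ []         px = px ∷ []
  All-∷ʳ⁺ (py ∷ pxs) px = py ∷ All-∷ʳ⁺ pxs px

  All-∷ʳ⁻ : ∀ {n x} {xs : Vec A n} → All P (xs ∷ʳ x) → All P xs
  All-∷ʳ⁻ {xs = []}    _          = []
  All-∷ʳ⁻ {xs = _ ∷ _} (py ∷ pxs) = py ∷ All-∷ʳ⁻ pxs

  All-replicate⁺ : ∀ n {x} → P x → All P (replicate n x)
  All-replicate⁺ zero    px = []
  All-replicate⁺ (suc n) px = px ∷ All-replicate⁺ n px

  All-zipWith⁺ : ∀ {n} {g : A → A → A} → (∀ {x y} → P x → P y → P (g x y)) →
                 {xs ys : Vec A n} → All P xs → All P ys → All P (zipWith g xs ys)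
  All-zipWith⁺ pg []         []         = []
  All-zipWith⁺ pg (px ∷ pxs) (py ∷ pys) = pg px py ∷ All-zipWith⁺ pg pxs pys

∈-allVecs⁺ : ∀ {m n} {V : Vec ℕ n} → All (_≤ m) V → V ∈ allVecs m n
∈-allVecs⁺ {m} {zero}  []         = here refl
∈-allVecs⁺ {m} {suc n} (x≤m ∷ V≤m) =
  ∈-concat⁺′ (∈-map⁺ _ (∈-allVecs⁺ V≤m))
             (∈-map⁺ (λ x → map (x ∷_) (allVecs m n)) (∈-upTo⁺ (s≤s x≤m)))

∈-allVecs⁻ : ∀ {m} n {V : Vec ℕ n} → V ∈ allVecs m n → All (_≤ m) V
∈-allVecs⁻     zero    {[]} _ = []
∈-allVecs⁻ {m} (suc n) V∈
  with _ , V∈Vs , Vs∈ ← ∈-concat⁻′ (map (λ x → map (x ∷_) (allVecs m n)) (upTo (suc m))) V∈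
  with x , x∈ , refl ← ∈-map⁻ (λ x → map (x ∷_) (allVecs m n)) Vs∈
  with W , W∈ , refl ← ∈-map⁻ (x ∷_) V∈Vs
  = ℕ.≤-pred (∈-upTo⁻ x∈) ∷ ∈-allVecs⁻ n W∈

module _ (f : CostFns) (β : ℚ) where

  costL≡costU : ∀ {n} t p (X : Vec ℕ n) →
                costL f β t p X + β * toℚ p ≡ costU f β t p X + β * toℚ (last (p ∷ X))
  costL≡costU t p []      = refl
  costL≡costU t p (x ∷ X) = begin-equality
    F + β * toℚ (x ∸ p) + L + β * toℚ p                 ≡⟨ ℚ.+-assoc (F + β * toℚ (x ∸ p)) L (β * toℚ p) ⟩
    F + β * toℚ (x ∸ p) + (L + β * toℚ p)               ≡⟨ interchange F (β * toℚ (x ∸ p)) L (β * toℚ p) ⟩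
    F + L + (β * toℚ (x ∸ p) + β * toℚ p)               ≡⟨ cong (_+_ (F + L)) (*-toℚ-∸-swap β x p) ⟩
    F + L + (β * toℚ (p ∸ x) + β * toℚ x)               ≡⟨ interchange F L (β * toℚ (p ∸ x)) (β * toℚ x) ⟩
    F + β * toℚ (p ∸ x) + (L + β * toℚ x)               ≡⟨ cong (_+_ (F + β * toℚ (p ∸ x))) (costL≡costU (suc t) x X) ⟩
    F + β * toℚ (p ∸ x) + (U + β * toℚ (last (x ∷ X)))  ≡⟨ ℚ.+-assoc (F + β * toℚ (p ∸ x)) U _ ⟨
    F + β * toℚ (p ∸ x) + U + β * toℚ (last (x ∷ X))    ∎
    where
    F L U : ℚ
    F = f t x
    L = costL f β (suc t) x X
    U = costU f β (suc t) x X

  CL-∷ʳ : ∀ {n} (P : Vec ℕ n) x → CL f β (P ∷ʳ x) ≡ CU f β (P ∷ʳ x) + β * toℚ x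
  CL-∷ʳ P x = begin-equality
    CL f β (P ∷ʳ x)                                ≡⟨ ℚ.+-identityʳ _ ⟨
    CL f β (P ∷ʳ x) + 0ℚ                           ≡⟨ cong (_+_ (CL f β (P ∷ʳ x))) (ℚ.*-zeroʳ β) ⟨
    CL f β (P ∷ʳ x) + β * toℚ 0                    ≡⟨ costL≡costU 1 0 (P ∷ʳ x) ⟩
    CU f β (P ∷ʳ x) + β * toℚ (last (0 ∷ (P ∷ʳ x))) ≡⟨ cong (λ y → CU f β (P ∷ʳ x) + β * toℚ y) (last-∷ʳ x (0 ∷ P)) ⟩
    CU f β (P ∷ʳ x) + β * toℚ x                    ∎

  module _ (m : ℕ) where

    hatCL-≤ : ∀ {n x} {Z : Vec ℕ (suc n)} → All (_≤ m) Z → last Z ≡ x →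
              hatCL m f β (suc n) x ≤ℚ CU f β Z + β * toℚ x
    hatCL-≤ {n} {Z = Z} Z≤m last[Z]≡x with initLast Z
    -- last is defined through initLast, so this match turns last Z into z.
    ... | P , z , refl with refl ← last[Z]≡x = begin
      hatCL m f β (suc n) z        ≤⟨ minList-≤ (∈-map⁺ (λ P → CL f β (P ∷ʳ z)) (∈-allVecs⁺ (All-∷ʳ⁻ Z≤m))) ⟩
      CL f β (P ∷ʳ z)              ≡⟨ CL-∷ʳ P z ⟩
      CU f β (P ∷ʳ z) + β * toℚ z  ∎

    hatCL-attained : ∀ {n x} → x ≤ m →
      Σ[ Y ∈ Vec ℕ (suc n) ] All (_≤ m) Y × last Y ≡ x × hatCL m f β (suc n) x ≡ CU f β Y + β * toℚ x
    hatCL-attained {n} {x} x≤m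
      with P , P∈ , min≡ ← ∈-map⁻ (λ P → CL f β (P ∷ʳ x))
                             (minList-∈ (∈-map⁺ _ (∈-allVecs⁺ (All-replicate⁺ n z≤n))))
      = P ∷ʳ x , All-∷ʳ⁺ (∈-allVecs⁻ n P∈) x≤m , last-∷ʳ x P , trans min≡ (CL-∷ʳ P x)

module _ {T m : ℕ} {f : CostFns} {β : ℚ} {{_ : NonNegative β}}
         (convex : ∀ t → 1 ≤ t → t ≤ T → Convex m (f t)) where

  stage : ℕ → ℕ → ℕ → ℚ
  stage t p′ p = f t p + β * toℚ (p′ ∸ p)

  stage-exchange : ∀ {t} → 1 ≤ t → t ≤ T → ∀ p′ q′ {p q} → p ≤ m → q ≤ m →
    stage t (p′ ⊔⁻ q′) (p ⊔⁻ q) + stage t (p′ ⊓⁺ q′) (p ⊓⁺ q) ≤ℚ stage t p′ p + stage t q′ q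
  stage-exchange {t} 1≤t t≤T p′ q′ {p} {q} p≤m q≤m = begin
    (F⊔ + B⊔) + (F⊓ + B⊓)  ≡⟨ interchange F⊔ B⊔ F⊓ B⊓ ⟩
    (F⊔ + F⊓) + (B⊔ + B⊓)  ≤⟨ ℚ.+-mono-≤ (convex-exchange {g = f t} (convex t 1≤t t≤T) p≤m q≤m)
                                          (*-toℚ-+-mono-≤ β {d⊔} {d⊓} {dp} {dq} (⊔⁻-⊓⁺-∸-submodular p′ q′ p q)) ⟩
    (Fp + Fq) + (Bp + Bq)  ≡⟨ interchange Fp Bp Fq Bq ⟨
    (Fp + Bp) + (Fq + Bq)  ∎
    where
    d⊔ d⊓ dp dq : ℕ
    d⊔ = p′ ⊔⁻ q′ ∸ (p ⊔⁻ q)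
    d⊓ = p′ ⊓⁺ q′ ∸ p ⊓⁺ q
    dp = p′ ∸ p
    dq = q′ ∸ q
    F⊔ F⊓ Fp Fq B⊔ B⊓ Bp Bq : ℚ
    F⊔ = f t (p ⊔⁻ q)
    F⊓ = f t (p ⊓⁺ q)
    Fp = f t p
    Fq = f t q
    B⊔ = β * toℚ d⊔
    B⊓ = β * toℚ d⊓
    Bp = β * toℚ dp
    Bq = β * toℚ dq

  costU-exchange : ∀ {n} t → t +ℕ n ≤ T → ∀ p′ q′ {P Q : Vec ℕ n} → All (_≤ m) P → All (_≤ m) Q →
    costU f β (suc t) (p′ ⊔⁻ q′) (zipWith _⊔⁻_ P Q) + costU f β (suc t) (p′ ⊓⁺ q′) (zipWith _⊓⁺_ P Q)
      ≤ℚ costU f β (suc t) p′ P + costU f β (suc t) q′ Q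
  costU-exchange t _ p′ q′ [] [] = ℚ.≤-refl
  costU-exchange {suc n} t t+n≤T p′ q′ {p ∷ P} {q ∷ Q} (p≤m ∷ P≤m) (q≤m ∷ Q≤m) = begin
    (S⊔ + R⊔) + (S⊓ + R⊓)  ≡⟨ interchange S⊔ R⊔ S⊓ R⊓ ⟩
    (S⊔ + S⊓) + (R⊔ + R⊓)  ≤⟨ ℚ.+-mono-≤ (stage-exchange (s≤s z≤n) 1+t≤T p′ q′ p≤m q≤m)
                                          (costU-exchange (suc t) 1+t+n≤T p q P≤m Q≤m) ⟩
    (Sp + Sq) + (Rp + Rq)  ≡⟨ interchange Sp Rp Sq Rq ⟨
    (Sp + Rp) + (Sq + Rq)  ∎
    where
    1+t+n≤T : suc t +ℕ n ≤ T
    1+t+n≤T = subst (_≤ T) (ℕ.+-suc t n) t+n≤T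
    1+t≤T : suc t ≤ T
    1+t≤T = ℕ.≤-trans (ℕ.m≤m+n (suc t) n) 1+t+n≤T
    S⊔ S⊓ Sp Sq R⊔ R⊓ Rp Rq : ℚ
    S⊔ = stage (suc t) (p′ ⊔⁻ q′) (p ⊔⁻ q)
    S⊓ = stage (suc t) (p′ ⊓⁺ q′) (p ⊓⁺ q)
    Sp = stage (suc t) p′ p
    Sq = stage (suc t) q′ q
    R⊔ = costU f β (suc (suc t)) (p ⊔⁻ q) (zipWith _⊔⁻_ P Q)
    R⊓ = costU f β (suc (suc t)) (p ⊓⁺ q) (zipWith _⊓⁺_ P Q)
    Rp = costU f β (suc (suc t)) p P
    Rq = costU f β (suc (suc t)) q Q

  minimizer-⊓⁺-≤ : ∀ {τ} {X Y : Vec ℕ τ} → τ ≤ T → IsMinimizerU m f β τ X → All (_≤ m) Y →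
                   CU f β (zipWith _⊓⁺_ X Y) ≤ℚ CU f β Y
  minimizer-⊓⁺-≤ {X = X} {Y} τ≤T (X≤m , X-min) Y≤m = +-cancelˡ-≤ (CU f β X) (begin
    CU f β X + CU f β (zipWith _⊓⁺_ X Y)                   ≤⟨ ℚ.+-monoˡ-≤ _ (X-min _ (All-zipWith⁺ ⊔⁻-≤ X≤m Y≤m)) ⟩
    CU f β (zipWith _⊔⁻_ X Y) + CU f β (zipWith _⊓⁺_ X Y)  ≤⟨ costU-exchange 0 τ≤T 0 0 X≤m Y≤m ⟩
    CU f β X + CU f β Y                                    ∎)

  hatCL-step : ∀ {n x} {X : Vec ℕ (suc n)} → suc n ≤ T → IsMinimizerU m f β (suc n) X → suc x ≤ last X →
               hatCL m f β (suc n) (suc x) ≤ℚ hatCL m f β (suc n) x + β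
  hatCL-step {n} {x} {X} τ≤T X-min@(X≤m , _) 1+x≤last[X]
    with Y , Y≤m , last[Y]≡x , hatCL[x]≡ ←
           hatCL-attained f β m {n} (ℕ.<⇒≤ (ℕ.≤-trans 1+x≤last[X] (All-last⁺ X≤m)))
    = begin
    hatCL m f β (suc n) (suc x)  ≤⟨ hatCL-≤ f β m (All-zipWith⁺ (λ p≤m _ → ⊓⁺-≤ p≤m) X≤m Y≤m) last[Z]≡1+x ⟩
    CU f β Z + β * toℚ (suc x)   ≤⟨ ℚ.+-monoˡ-≤ _ (minimizer-⊓⁺-≤ τ≤T X-min Y≤m) ⟩
    CU f β Y + β * toℚ (suc x)   ≡⟨ cong (_+_ (CU f β Y)) (*-toℚ-suc β x) ⟩
    CU f β Y + (β * toℚ x + β)   ≡⟨ ℚ.+-assoc (CU f β Y) (β * toℚ x) β ⟨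
    CU f β Y + β * toℚ x + β     ≡⟨ cong (_+ β) hatCL[x]≡ ⟨
    hatCL m f β (suc n) x + β    ∎
    where
    Z : Vec ℕ (suc n)
    Z = zipWith _⊓⁺_ X Y
    last[Z]≡1+x : last Z ≡ suc x
    last[Z]≡1+x = trans (last-zipWith _⊓⁺_ X Y)
                        (trans (cong (λ y → last X ⊓ suc y) last[Y]≡x) (ℕ.m≥n⇒m⊓n≡n 1+x≤last[X]))

lemma3p5 : (T m : ℕ) (β : ℚ) (f : CostFns) → 0ℚ < β → Admissible T m f →
    (τ : ℕ) → 1 ≤ τ → τ ≤ T →
    (xU : ℕ) → IsXU m f β τ xU →
    (x : ℕ) → 1 ≤ x → x ≤ xU →
    hatCL m f β τ x - hatCL m f β τ (x ∸ 1) ≤ℚ β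
lemma3p5 T m β f 0<β (_ , convex) (suc n) _ τ≤T xU ((X , X-min , lastOr0[X]≡xU) , _) (suc x) _ 1+x≤xU =
  p≤q+r⇒p-q≤r (hatCL-step convex′ τ≤T X-min 1+x≤last[X])
  where
  instance
    β≥0 : NonNegative β
    β≥0 = ℚ.pos⇒nonNeg β {{positive 0<β}}
  convex′ : ∀ t → 1 ≤ t → t ≤ T → Convex m (f t)
  convex′ t 1≤t t≤T x = convex t x 1≤t t≤T
  1+x≤last[X] : suc x ≤ last X
  1+x≤last[X] = subst (suc x ≤_) (trans (sym lastOr0[X]≡xU) (lastOr0≡last X)) 1+x≤xU
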